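{- Every trace $\mu_1,\dots,\mu_n$ (for any discreet clean process $P_0$ and stack $\sigma_0$) is well-bracketed: for all $i<j$, if $\mu_i$ is a question and $\mu_j$ is an answer such that $\mu_i\not\curvearrowright\mu_k$ and $\mu_k\not\curvearrowright\mu_j$ for all $i<k<j$, then $\mu_i\curvearrowright\mu_j$.
   Context: Asynchronous $\pi$-calculus: processes $P ::= a\langle\tilde b\rangle \mid\ !a(\tilde b).P \mid P|Q \mid (\nu a)P \mid G$, $G ::= \mathbf 0 \mid a(\tilde b).P \mid \tau.P \mid [a=b]G \mid G+G'$, well-sorted; $\xrightarrow{\mu}$ is the standard early LTS of the asynchronous $\pi$-calculus (actions $\tau$, $a(\tilde b)$, $(\nu\tilde c)a\langle\tilde b\rangle$). Names: output-controlled ($x,y,z$), input-controlled ($u,v,w$), continuation ($p,q,r$); $a,b,c$ range over output- and input-controlled names. Outputs at output-controlled names carry tuples $\tilde a,p$ ending with exactly one continuation name; continuation names are transmitted only this way. Sequential typing (continuation names count as output-controlled): $\vdash_1 u(\tilde a).P$ if $\vdash_1P$; $\vdash_0 x(\tilde a).P$, $\vdash_0 !x(\tilde a).P$ if $\vdash_1P$; $\vdash_1x\langle\tilde a\rangle$; $\vdash_0u\langle\tilde a\rangle$; $\vdash_\eta(\nu a)P$ if $\vdash_\eta P$; $\vdash_0\mathbf0$; $\vdash_{\eta_1+\eta_2}P|Q$ if $\vdash_{\eta_1}P,\vdash_{\eta_2}Q$, $\eta_1+\eta_2\le1$; $\vdash_\eta G_1+G_2$ if $\vdash_\eta G_1,G_2$;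 $\vdash_\eta\tau.P$ if $\vdash_\eta P$; $\vdash_0[a=b]G$ if $\vdash_0G$. Type-allowed $\eta\vdash P\xrightarrow{\mu}P'$: $\vdash_\eta P$, $P\xrightarrow{\mu}P'$, and $\eta=0$ or $\mu=\tau$ or ($\eta=1$ and $\mu$ an input at an input-controlled name or an output at an output-controlled name). Stacks: sequences of $p^{\mathrm O}$/$p^{\mathrm I}$ with alternating tags, ending with an output tag unless empty, each name at most once per tag, and if a name has both tags the input occurrence immediately follows the output one; clean if no name has both tags; $\mathrm{seq}(\sigma)=1$ if $\sigma$ starts with an output tag, else $0$; $|\sigma|$ the length. Interleaving and typing $\vdash_\sigma P$: $\sigma_1\in\sigma_2\between\sigma_3$ iff $\sigma_1$ is a stack derivable by $\emptyset\in\emptyset\between\emptyset$, $t,\sigma_1\in\sigma_2\between t,\sigma_3$, $t,\sigma_1\in t,\sigma_2\between\sigma_3$ from $\sigma_1\in\sigma_2\between\sigma_3$; $\vdash_{p^{\mathrm O}}p\langle\tilde a\rangle$; $\vdash_{p^{\mathrm O}}x\langle\tilde a,p\rangle$; $\vdash_\emptyset u\langle\tilde a\rangle$; $\vdash_{q^{\mathrm I},p^{\mathrm O}}q(\tilde a).P$ if $\vdash_{p^{\mathrm O}}P$, $p\ne q$; $\vdash_\emptyset x(\tilde a,p).P$, $\vdash_\emptyset !x(\tilde a,p).P$ if $\vdash_{p^{\mathrm O}}P$; $\vdash_{p^{\mathrm O}}u(\tilde a).P$ if $\vdash_{p^{\mathrm O}}P$; $\vdash_\emptyset\mathbf0$;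 $\vdash_{\xi,\sigma'}(\nu p)P$ if $\vdash_{\xi,p^{\mathrm O},p^{\mathrm I},\sigma'}P$ with $\xi$ empty or ending with an input tag; $\vdash_\sigma(\nu p)P$ if $\vdash_\sigma P$, $p\notin\sigma$; $\vdash_\sigma(\nu a)P$ if $\vdash_\sigma P$; $\vdash_\emptyset[a=b]P$ if $\vdash_\emptyset P$; $\vdash_{\sigma''}P|Q$ if $\vdash_\sigma P,\vdash_{\sigma'}Q$, $\sigma''\in\sigma\between\sigma'$; $\vdash_\sigma\tau.P$, $\vdash_\sigma P+Q$ from $\vdash_\sigma P$ (and $\vdash_\sigma Q$) when $|\sigma|\le1$. $P$ is clean if $\vdash_\sigma P$ for a clean $\sigma$. Typed transition $\sigma\vdash P\xrightarrow{\mu}P'$: $\vdash_\sigma P$; $\mathrm{seq}(\sigma)\vdash P\xrightarrow{\mu}P'$; if a continuation name $p\in\mathrm{fn}(\mu)$ occurs in $\sigma$ then $\sigma=p^{\mathrm O},\sigma'$ or $p^{\mathrm I},\sigma'$, and if $p$ occurs in $\sigma'$ it is not the subject of $\mu$. $\langle\sigma;P\rangle\xrightarrow{\mu}\langle\sigma';P'\rangle$ holds when $\sigma\vdash P\xrightarrow{\mu}P'$ and: if $\mu=(\nu\tilde b)p\langle\tilde a\rangle$ then $\sigma=p^{\mathrm O},\sigma'$; if $\mu=p(\tilde a)$ then $\sigma=p^{\mathrm I},\sigma'$; if $\mu=(\nu\tilde c,p)a\langle\tilde b,p\rangle$ then $\sigma'=p^{\mathrm I},\sigma$; if $\mu=(\nu\tilde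 c)a\langle\tilde b,p\rangle$ ($p$ free) then $\sigma=p^{\mathrm O},\sigma'$; if $\mu=a(\tilde b,p)$ then $\sigma'=p^{\mathrm O},\sigma$; if $\mu=\tau$ then $\sigma'=\sigma''$ when $\sigma=p^{\mathrm O},p^{\mathrm I},\sigma''$ and $p\notin\mathrm{fn}(P')$, else $\sigma'=\sigma$. A typed transition is discreet if no continuation name in the object of $\mu$ is free in $\sigma$. $P$ is discreet if no free continuation name of $P$ appears in the object of an output, and for every subprocess $x(\tilde a,q).Q$, $q$ does not appear in the object of an output in $Q$. Trace: $\mu_1,\dots,\mu_n$ is a trace for a discreet clean $P_0$ and stack $\sigma_0$ if there are $\sigma_1,\dots,\sigma_n$, $P_1,\dots,P_n$ with discreet transitions $\langle\sigma_j;P_j\rangle\xrightarrow{\mu_{j+1}}\langle\sigma_{j+1};P_{j+1}\rangle$ for $0\le j<n$, where every continuation name in the object of $\mu_{j+1}$ appears in no $\mu_i$ with $i\le j$. $\mu_i\curvearrowright\mu_j$ if $i<j$ and either $\mu_i=(\nu\tilde c,p)a\langle\tilde b,p\rangle$ and $\mu_j=p(\tilde a')$, or $\mu_i=a(\tilde b,p)$ and $\mu_j=(\nu\tilde c)p\langle\tilde a'\rangle$. Actions with a continuation name in object position are questions; actions with a continuation name as subject are answers. -}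

module Defs where

-- Asynchronous pi-calculus with a sorting, in locally-nameless style:
-- free names are atoms (a sort together with an index, so every sort has
-- infinitely many names), bound names are de Bruijn indices.  Alpha-equivalent
-- named processes therefore have the same representation; binders are opened
-- with fresh atoms wherever the paper's rules mention the bound names.

open import Data.Nat using (ℕ; zero; suc; _+_; _≤_)
open import Data.Fin using (Fin) renaming (_<_ to _<ᶠ_)
open import Data.List using (List; []; _∷_; _++_; _∷ʳ_; map; length; lookup; filter; [_])
open import Data.List.Membership.Propositional using (_∈_; _∉_)
open import Data.List.Relation.Unary.All using (All)
open import Data.List.Relation.Unary.Unique.Propositional using (Unique)
open import Data.Maybe using (Maybe; just; nothing)
open import Data.Product using (Σ; ∃; _×_; _,_; proj₁; proj₂)
open import Data.Sum using (_⊎_)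
open import Data.Empty using (⊥)
open import Data.Bool using (Bool; true; false; if_then_else_)
open import Relation.Nullary using (¬_; Dec; yes; no; does)
open import Relation.Binary.PropositionalEquality using (_≡_; _≢_; refl)
open import Relation.Binary.Definitions using (DecidableEquality)
import Data.Nat.Properties as ℕP

-- The three kinds of names: output-controlled (x,y,z), input-controlled (u,v,w),
-- continuation (p,q,r).
data Kind : Set where
  oc ic cont : Kind

_≟K_ : DecidableEquality Kind
oc ≟K oc = yes refl
oc ≟K ic = no (λ ())
oc ≟K cont = no (λ ())
ic ≟K oc = no (λ ())
ic ≟K ic = yes refl
ic ≟K cont = no (λ ())
cont ≟K oc = no (λ ())
cont ≟K ic = no (λ ())
cont ≟K cont = yes refl

NotCont : Kind → Set
NotCont k = k ≢ cont

-- A sorting (in the sense of Milner's sortings for the polyadic pi-calculus):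
-- every sort has a kind and an object sort (the sorts of the transmitted tuple).
-- The discipline of the paper: outputs at output-controlled names carry tuples
-- ending with exactly one continuation name; continuation names are
-- transmitted only this way.
record Sorting : Set₁ where
  field
    Sort    : Set
    _≟S_    : DecidableEquality Sort
    kind    : Sort → Kind
    ob      : Sort → List Sort
    ocShape : ∀ s → kind s ≡ oc →
              ∃ λ l → ∃ λ c → ob s ≡ l ∷ʳ c × kind c ≡ cont × All (λ t → NotCont (kind t)) l
    noCont  : ∀ s → kind s ≢ oc → All (λ t → NotCont (kind t)) (ob s)

module Calculus (𝒮 : Sorting) where
  open Sorting 𝒮

  record Atom : Set where
    constructor at
    field
      srt : Sort
      idx : ℕ
  open Atom public

  _≟A_ : DecidableEquality Atom
  at s i ≟A at t j with s ≟S t | i ℕP.≟ j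
  ... | yes refl | yes refl = yes refl
  ... | no ne | _ = no (λ { refl → ne refl })
  ... | yes _ | no ne = no (λ { refl → ne refl })

  kindA : Atom → Kind
  kindA a = kind (srt a)

  data Nm : Set where
    fr : Atom → Nm
    bv : ℕ → Nm

  -- A binder over a tuple of k names binds the indices 0..k-1
  -- (index i is the i-th name of the tuple).
  --   P ::= a<b> | !a(b).P | P|Q | (nu a)P | G
  --   G ::= 0 | a(b).P | tau.P | [a=b]G | G+G

  data Proc : Set
  data Grd : Set

  data Proc where
    out : Nm → List Nm → Proc
    rep : Nm → List Sort → Proc → Proc
    par : Proc → Proc → Proc
    nu  : Sort → Proc → Proc
    grd : Grd → Proc

  data Grd where
    nil : Grd
    inp : Nm → List Sort → Proc → Grd
    tau : Proc → Grd
    mat : Nm → Nm → Grd → Grd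
    sum : Grd → Grd → Grd

  faN : Nm → List Atom
  faN (fr a) = [ a ]
  faN (bv _) = []

  faNs : List Nm → List Atom
  faNs [] = []
  faNs (n ∷ ns) = faN n ++ faNs ns

  faP : Proc → List Atom
  faG : Grd → List Atom
  faP (out a bs) = faN a ++ faNs bs
  faP (rep a ss P) = faN a ++ faP P
  faP (par P Q) = faP P ++ faP Q
  faP (nu s P) = faP P
  faP (grd G) = faG G
  faG nil = []
  faG (inp a ss P) = faN a ++ faP P
  faG (tau P) = faP P
  faG (mat a b G) = faN a ++ faN b ++ faG G
  faG (sum G H) = faG G ++ faG H

  shiftN : Nm → Nm
  shiftN (fr a) = fr a
  shiftN (bv i) = bv (suc i)

  pick : List Atom → ℕ → Nm
  pick [] i = bv i
  pick (a ∷ as) zero = fr a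
  pick (a ∷ as) (suc i) = pick as i

  opn : ℕ → List Atom → ℕ → Nm
  opn zero as i = pick as i
  opn (suc d) as zero = bv zero
  opn (suc d) as (suc i) = shiftN (opn d as i)

  openN : ℕ → List Atom → Nm → Nm
  openN d as (fr a) = fr a
  openN d as (bv i) = opn d as i

  openP : ℕ → List Atom → Proc → Proc
  openG : ℕ → List Atom → Grd → Grd
  openP d as (out a bs) = out (openN d as a) (map (openN d as) bs)
  openP d as (rep a ss P) = rep (openN d as a) ss (openP (length ss + d) as P)
  openP d as (par P Q) = par (openP d as P) (openP d as Q)
  openP d as (nu s P) = nu s (openP (suc d) as P)
  openP d as (grd G) = grd (openG d as G)
  openG d as nil = nil
  openG d as (inp a ss P) = inp (openN d as a) ss (openP (length ss + d) as P)
  openG d as (tau P) = tau (openP d as P)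
  openG d as (mat a b G) = mat (openN d as a) (openN d as b) (openG d as G)
  openG d as (sum G H) = sum (openG d as G) (openG d as H)

  inst : List Atom → Proc → Proc
  inst as P = openP 0 as P

  cls : ℕ → ℕ → Nm
  cls zero i = bv (suc i)
  cls (suc d) zero = bv zero
  cls (suc d) (suc i) = shiftN (cls d i)

  closeN : ℕ → Atom → Nm → Nm
  closeN d n (fr a) = if does (a ≟A n) then bv d else fr a
  closeN d n (bv i) = cls d i

  closeP : ℕ → Atom → Proc → Proc
  closeG : ℕ → Atom → Grd → Grd
  closeP d n (out a bs) = out (closeN d n a) (map (closeN d n) bs)
  closeP d n (rep a ss P) = rep (closeN d n a) ss (closeP (length ss + d) n P)
  closeP d n (par P Q) = par (closeP d n P) (closeP d n Q)
  closeP d n (nu s P) = nu s (closeP (suc d) n P)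
  closeP d n (grd G) = grd (closeG d n G)
  closeG d n nil = nil
  closeG d n (inp a ss P) = inp (closeN d n a) ss (closeP (length ss + d) n P)
  closeG d n (tau P) = tau (closeP d n P)
  closeG d n (mat a b G) = mat (closeN d n a) (closeN d n b) (closeG d n G)
  closeG d n (sum G H) = sum (closeG d n G) (closeG d n H)

  nuClose : List Atom → Proc → Proc
  nuClose [] R = R
  nuClose (c ∷ cs) R = nu (srt c) (closeP 0 c (nuClose cs R))

  FreshList : List Atom → List Atom → Set
  FreshList as avoid = Unique as × All (λ a → a ∉ avoid) as

  -- Well-sortedness (also forces local closedness at the top level)

  sortN : List Sort → Nm → Maybe Sort
  sortN Γ (fr a) = just (srt a)
  sortN [] (bv i) = nothing
  sortN (s ∷ Γ) (bv zero) = just s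
  sortN (s ∷ Γ) (bv (suc i)) = sortN Γ (bv i)

  data WS (Γ : List Sort) : Proc → Set where
    wsOut : ∀ {a bs s} → sortN Γ a ≡ just s → map (sortN Γ) bs ≡ map just (ob s) →
            WS Γ (out a bs)
    wsRep : ∀ {a ss P s} → sortN Γ a ≡ just s → ss ≡ ob s → WS (ss ++ Γ) P →
            WS Γ (rep a ss P)
    wsPar : ∀ {P Q} → WS Γ P → WS Γ Q → WS Γ (par P Q)
    wsNu  : ∀ {s P} → WS (s ∷ Γ) P → WS Γ (nu s P)
    wsNil : WS Γ (grd nil)
    wsInp : ∀ {a ss P s} → sortN Γ a ≡ just s → ss ≡ ob s → WS (ss ++ Γ) P →
            WS Γ (grd (inp a ss P))
    wsTau : ∀ {P} → WS Γ P → WS Γ (grd (tau P))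
    wsMat : ∀ {a b G s t} → sortN Γ a ≡ just s → NotCont (kind s) →
            sortN Γ b ≡ just t → NotCont (kind t) → WS Γ (grd G) →
            WS Γ (grd (mat a b G))
    wsSum : ∀ {G H} → WS Γ (grd G) → WS Γ (grd H) → WS Γ (grd (sum G H))

  WellSorted : Proc → Set
  WellSorted P = WS [] P

  data Act : Set where
    τ    : Act
    inA  : Atom → List Atom → Act
    outA : List Atom → Atom → List Atom → Act

  bnA : Act → List Atom
  bnA (outA cs a bs) = cs
  bnA _ = []

  namesA : Act → List Atom
  namesA τ = []
  namesA (inA a bs) = a ∷ bs
  namesA (outA cs a bs) = a ∷ bs ++ cs

  objs : Act → List Atom
  objs τ = []
  objs (inA a bs) = bs
  objs (outA cs a bs) = bs

  subjOf : Act → Maybe Atom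
  subjOf τ = nothing
  subjOf (inA a bs) = just a
  subjOf (outA cs a bs) = just a

  _∈fn_ : Atom → Act → Set
  p ∈fn τ = ⊥
  p ∈fn inA a bs = p ∈ a ∷ bs
  p ∈fn outA cs a bs = p ∈ a ∷ bs × p ∉ cs

  data Step : Proc → Act → Proc → Set where
    sOut  : ∀ {a bs} → Step (out (fr a) (map fr bs)) (outA [] a bs) (grd nil)
    sInp  : ∀ {a ss P bs} → map srt bs ≡ ss →
            Step (grd (inp (fr a) ss P)) (inA a bs) (inst bs P)
    sRep  : ∀ {a ss P bs} → map srt bs ≡ ss →
            Step (rep (fr a) ss P) (inA a bs) (par (inst bs P) (rep (fr a) ss P))
    sTau  : ∀ {P} → Step (grd (tau P)) τ P
    sSumL : ∀ {G H μ P'} → Step (grd G) μ P' → Step (grd (sum G H)) μ P'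
    sSumR : ∀ {G H μ P'} → Step (grd H) μ P' → Step (grd (sum G H)) μ P'
    sMat  : ∀ {a G μ P'} → Step (grd G) μ P' → Step (grd (mat (fr a) (fr a) G)) μ P'
    sParL : ∀ {P Q μ P'} → Step P μ P' → All (λ c → c ∉ faP Q) (bnA μ) →
            Step (par P Q) μ (par P' Q)
    sParR : ∀ {P Q μ Q'} → Step Q μ Q' → All (λ c → c ∉ faP P) (bnA μ) →
            Step (par P Q) μ (par P Q')
    sComL : ∀ {P Q P' Q' cs a bs} → Step P (outA cs a bs) P' → Step Q (inA a bs) Q' →
            All (λ c → c ∉ faP Q) cs → Step (par P Q) τ (nuClose cs (par P' Q'))
    sComR : ∀ {P Q P' Q' cs a bs} → Step P (inA a bs) P' → Step Q (outA cs a bs) Q' →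
            All (λ c → c ∉ faP P) cs → Step (par P Q) τ (nuClose cs (par P' Q'))
    sRes  : ∀ {s P μ P' n} → srt n ≡ s → n ∉ faP P → n ∉ namesA μ →
            Step (inst [ n ] P) μ P' → Step (nu s P) μ (nu s (closeP 0 n P'))
    sOpen : ∀ {s P P' n cs a bs} → srt n ≡ s → n ∉ faP P →
            Step (inst [ n ] P) (outA cs a bs) P' → n ∈ bs → n ≢ a → n ∉ cs →
            Step (nu s P) (outA (n ∷ cs) a bs) P'

  -- Sequential typing  |-_eta P  (continuation names count as output-controlled)

  OCish : Kind → Set
  OCish k = k ≡ oc ⊎ k ≡ cont

  data SeqTy : ℕ → Proc → Set where
    qInU  : ∀ {u ss P as} → kindA u ≡ ic → FreshList as (faP (grd (inp (fr u) ss P))) →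
            map srt as ≡ ss → SeqTy 1 (inst as P) → SeqTy 1 (grd (inp (fr u) ss P))
    qInX  : ∀ {x ss P as} → OCish (kindA x) → FreshList as (faP (grd (inp (fr x) ss P))) →
            map srt as ≡ ss → SeqTy 1 (inst as P) → SeqTy 0 (grd (inp (fr x) ss P))
    qRepX : ∀ {x ss P as} → OCish (kindA x) → FreshList as (faP (rep (fr x) ss P)) →
            map srt as ≡ ss → SeqTy 1 (inst as P) → SeqTy 0 (rep (fr x) ss P)
    qOutX : ∀ {x bs} → OCish (kindA x) → SeqTy 1 (out (fr x) bs)
    qOutU : ∀ {u bs} → kindA u ≡ ic → SeqTy 0 (out (fr u) bs)
    qNu   : ∀ {η s P n} → srt n ≡ s → n ∉ faP P → SeqTy η (inst [ n ] P) → SeqTy η (nu s P)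
    qNil  : SeqTy 0 (grd nil)
    qPar  : ∀ {η₁ η₂ P Q} → SeqTy η₁ P → SeqTy η₂ Q → η₁ + η₂ ≤ 1 → SeqTy (η₁ + η₂) (par P Q)
    qSum  : ∀ {η G H} → SeqTy η (grd G) → SeqTy η (grd H) → SeqTy η (grd (sum G H))
    qTau  : ∀ {η P} → SeqTy η P → SeqTy η (grd (tau P))
    qMat  : ∀ {a b G} → SeqTy 0 (grd G) → SeqTy 0 (grd (mat a b G))

  InAtIC : Act → Set
  InAtIC (inA a bs) = kindA a ≡ ic
  InAtIC _ = ⊥

  OutAtOC : Act → Set
  OutAtOC (outA cs a bs) = OCish (kindA a)
  OutAtOC _ = ⊥

  TypeAllowed : ℕ → Proc → Act → Proc → Set
  TypeAllowed η P μ P' =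
    SeqTy η P × Step P μ P' × (η ≡ 0 ⊎ μ ≡ τ ⊎ (η ≡ 1 × (InAtIC μ ⊎ OutAtOC μ)))

  data Tag : Set where
    O I : Tag

  _≟T_ : DecidableEquality Tag
  O ≟T O = yes refl
  O ≟T I = no (λ ())
  I ≟T O = no (λ ())
  I ≟T I = yes refl

  Stack : Set
  Stack = List (Tag × Atom)

  names : Stack → List Atom
  names σ = map proj₂ σ

  tagged : Tag → Stack → List Atom
  tagged t [] = []
  tagged t ((t' , p) ∷ σ) = if does (t ≟T t') then p ∷ tagged t σ else tagged t σ

  data Alternating : Stack → Set where
    altNil  : Alternating []
    altOne  : ∀ {e} → Alternating [ e ]
    altCons : ∀ {e e' σ} → proj₁ e ≢ proj₁ e' → Alternating (e' ∷ σ) →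
              Alternating (e ∷ e' ∷ σ)

  record IsStack (σ : Stack) : Set where
    field
      conts : All (λ e → kindA (proj₂ e) ≡ cont) σ
      alt   : Alternating σ
      ends  : σ ≡ [] ⊎ ∃ λ ξ → ∃ λ p → σ ≡ ξ ∷ʳ (O , p)
      onceO : Unique (tagged O σ)
      onceI : Unique (tagged I σ)
      adj   : ∀ p → (O , p) ∈ σ → (I , p) ∈ σ →
              ∃ λ ξ → ∃ λ σ' → σ ≡ ξ ++ (O , p) ∷ (I , p) ∷ σ'

  CleanStack : Stack → Set
  CleanStack σ = IsStack σ × (∀ p → (O , p) ∈ σ → (I , p) ∉ σ)

  seqOf : Stack → ℕ
  seqOf [] = 0
  seqOf ((O , _) ∷ _) = 1
  seqOf ((I , _) ∷ _) = 0

  data Inter : Stack → Stack → Stack → Set where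
    iNil : Inter [] [] []
    iR   : ∀ {t σ₁ σ₂ σ₃} → Inter σ₁ σ₂ σ₃ → Inter (t ∷ σ₁) σ₂ (t ∷ σ₃)
    iL   : ∀ {t σ₁ σ₂ σ₃} → Inter σ₁ σ₂ σ₃ → Inter (t ∷ σ₁) (t ∷ σ₂) σ₃

  Interleaving : Stack → Stack → Stack → Set
  Interleaving σ₁ σ₂ σ₃ = IsStack σ₁ × Inter σ₁ σ₂ σ₃

  EmptyOrEndsI : Stack → Set
  EmptyOrEndsI ξ = ξ ≡ [] ⊎ ∃ λ ξ' → ∃ λ q → ξ ≡ ξ' ∷ʳ (I , q)

  -- stack typing  |-_σ P   (bound names are chosen fresh, Barendregt-style)
  data STy : Stack → Proc → Set where
    tOutC : ∀ {p bs} → kindA p ≡ cont → STy [ (O , p) ] (out (fr p) bs)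
    tOutX : ∀ {x p bs} → kindA x ≡ oc → kindA p ≡ cont →
            STy [ (O , p) ] (out (fr x) (bs ∷ʳ fr p))
    tOutU : ∀ {u bs} → kindA u ≡ ic → STy [] (out (fr u) bs)
    tInC  : ∀ {q p ss P as} → kindA q ≡ cont → p ≢ q →
            FreshList as (faP (grd (inp (fr q) ss P)) ++ p ∷ q ∷ []) → map srt as ≡ ss →
            STy [ (O , p) ] (inst as P) →
            STy ((I , q) ∷ (O , p) ∷ []) (grd (inp (fr q) ss P))
    tInX  : ∀ {x p ss P as} → kindA x ≡ oc → kindA p ≡ cont →
            FreshList (as ∷ʳ p) (faP (grd (inp (fr x) ss P))) → map srt (as ∷ʳ p) ≡ ss →
            STy [ (O , p) ] (inst (as ∷ʳ p) P) → STy [] (grd (inp (fr x) ss P))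
    tRepX : ∀ {x p ss P as} → kindA x ≡ oc → kindA p ≡ cont →
            FreshList (as ∷ʳ p) (faP (rep (fr x) ss P)) → map srt (as ∷ʳ p) ≡ ss →
            STy [ (O , p) ] (inst (as ∷ʳ p) P) → STy [] (rep (fr x) ss P)
    tInU  : ∀ {u p ss P as} → kindA u ≡ ic →
            FreshList as (faP (grd (inp (fr u) ss P)) ++ [ p ]) → map srt as ≡ ss →
            STy [ (O , p) ] (inst as P) → STy [ (O , p) ] (grd (inp (fr u) ss P))
    tNil  : STy [] (grd nil)
    tNuC  : ∀ {ξ σ' s P p} → kind s ≡ cont → EmptyOrEndsI ξ → srt p ≡ s →
            p ∉ faP P → p ∉ names (ξ ++ σ') →
            STy (ξ ++ (O , p) ∷ (I , p) ∷ σ') (inst [ p ] P) → STy (ξ ++ σ') (nu s P)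
    tNu   : ∀ {σ s P a} → srt a ≡ s → a ∉ faP P → a ∉ names σ →
            STy σ (inst [ a ] P) → STy σ (nu s P)
    tMat  : ∀ {a b G} → STy [] (grd G) → STy [] (grd (mat a b G))
    tPar  : ∀ {σ σ' σ'' P Q} → STy σ P → STy σ' Q → Interleaving σ'' σ σ' →
            STy σ'' (par P Q)
    tTau  : ∀ {σ P} → length σ ≤ 1 → STy σ P → STy σ (grd (tau P))
    tSum  : ∀ {σ G H} → length σ ≤ 1 → STy σ (grd G) → STy σ (grd H) →
            STy σ (grd (sum G H))

  Clean : Proc → Set
  Clean P = ∃ λ σ → CleanStack σ × STy σ P

  TyCond : Stack → Act → Set
  TyCond σ μ = ∀ p → kindA p ≡ cont → p ∈fn μ → p ∈ names σ →
               ∃ λ t → ∃ λ σ' → σ ≡ (t , p) ∷ σ' × (p ∈ names σ' → subjOf μ ≢ just p)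

  TyTrans : Stack → Proc → Act → Proc → Set
  TyTrans σ P μ P' = STy σ P × TypeAllowed (seqOf σ) P μ P' × TyCond σ μ

  NoLastCont : List Atom → Set
  NoLastCont bs = ∀ bs' p → bs ≡ bs' ∷ʳ p → kindA p ≢ cont

  data StackStep : Stack → Act → Proc → Stack → Set where
    kOutC  : ∀ {σ cs a bs P'} → kindA a ≡ cont →
             StackStep ((O , a) ∷ σ) (outA cs a bs) P' σ
    kInC   : ∀ {σ a bs P'} → kindA a ≡ cont →
             StackStep ((I , a) ∷ σ) (inA a bs) P' σ
    kOutQb : ∀ {σ cs a bs p P'} → NotCont (kindA a) → kindA p ≡ cont → p ∈ cs →
             StackStep σ (outA cs a (bs ∷ʳ p)) P' ((I , p) ∷ σ)
    kOutQf : ∀ {σ cs a bs p P'} → NotCont (kindA a) → kindA p ≡ cont → p ∉ cs →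
             StackStep ((O , p) ∷ σ) (outA cs a (bs ∷ʳ p)) P' σ
    kInQ   : ∀ {σ a bs p P'} → NotCont (kindA a) → kindA p ≡ cont →
             StackStep σ (inA a (bs ∷ʳ p)) P' ((O , p) ∷ σ)
    kOut   : ∀ {σ cs a bs P'} → NotCont (kindA a) → NoLastCont bs →
             StackStep σ (outA cs a bs) P' σ
    kIn    : ∀ {σ a bs P'} → NotCont (kindA a) → NoLastCont bs →
             StackStep σ (inA a bs) P' σ
    kTauPop  : ∀ {σ p P'} → p ∉ faP P' →
               StackStep ((O , p) ∷ (I , p) ∷ σ) τ P' σ
    kTauKeep : ∀ {σ P'} → (∀ p σ'' → σ ≡ (O , p) ∷ (I , p) ∷ σ'' → p ∈ faP P') →
               StackStep σ τ P' σ

  ConfStep : Stack → Proc → Act → Stack → Proc → Set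
  ConfStep σ P μ σ' P' = TyTrans σ P μ P' × StackStep σ μ P' σ'

  DiscreetT : Stack → Act → Set
  DiscreetT σ μ = ∀ p → kindA p ≡ cont → p ∈ objs μ → p ∉ names σ

  -- Discreet processes: no free continuation name of P is an output object,
  -- and for each x(a~,q).Q, q is not an output object in Q.  F is the list of
  -- such forbidden atoms (binders are opened with fresh atoms).

  contsOf : List Atom → List Atom
  contsOf = filter (λ a → kindA a ≟K cont)

  data DiscF (F : List Atom) : Proc → Set where
    dOut : ∀ {a bs} → All (λ b → ∀ p → b ≡ fr p → p ∉ F) bs → DiscF F (out a bs)
    dRep : ∀ {a ss P as} → FreshList as (faP (rep a ss P) ++ F) → map srt as ≡ ss →
           DiscF (F ++ contsOf as) (inst as P) → DiscF F (rep a ss P)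
    dPar : ∀ {P Q} → DiscF F P → DiscF F Q → DiscF F (par P Q)
    dNu  : ∀ {s P n} → srt n ≡ s → n ∉ faP P → n ∉ F → DiscF F (inst [ n ] P) →
           DiscF F (nu s P)
    dNil : DiscF F (grd nil)
    dInp : ∀ {a ss P as} → FreshList as (faP (grd (inp a ss P)) ++ F) → map srt as ≡ ss →
           DiscF (F ++ contsOf as) (inst as P) → DiscF F (grd (inp a ss P))
    dTau : ∀ {P} → DiscF F P → DiscF F (grd (tau P))
    dMat : ∀ {a b G} → DiscF F (grd G) → DiscF F (grd (mat a b G))
    dSum : ∀ {G H} → DiscF F (grd G) → DiscF F (grd H) → DiscF F (grd (sum G H))

  Discreet : Proc → Set
  Discreet P = DiscF (contsOf (faP P)) P

  data Run : Stack → Proc → List Act → Set where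
    rNil  : ∀ {σ P} → Run σ P []
    rCons : ∀ {σ P μ σ' P' ms} → ConfStep σ P μ σ' P' → DiscreetT σ μ →
            Run σ' P' ms → Run σ P (μ ∷ ms)

  FreshObjs : List Act → Set
  FreshObjs ms = ∀ (i j : Fin (length ms)) → i <ᶠ j → ∀ p → kindA p ≡ cont →
                 p ∈ objs (lookup ms j) → p ∉ namesA (lookup ms i)

  IsTrace : Stack → Proc → List Act → Set
  IsTrace σ P ms = Run σ P ms × FreshObjs ms

  data Points : Act → Act → Set where
    ptOut : ∀ {cs a bs p bs'} → NotCont (kindA a) → kindA p ≡ cont → p ∈ cs →
            Points (outA cs a (bs ∷ʳ p)) (inA p bs')
    ptIn  : ∀ {a bs p cs' bs'} → NotCont (kindA a) → kindA p ≡ cont →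
            Points (inA a (bs ∷ʳ p)) (outA cs' p bs')

  Arrow : (ms : List Act) → Fin (length ms) → Fin (length ms) → Set
  Arrow ms i j = i <ᶠ j × Points (lookup ms i) (lookup ms j)

  Question : Act → Set
  Question μ = ∃ λ p → p ∈ objs μ × kindA p ≡ cont

  Answer : Act → Set
  Answer μ = ∃ λ p → subjOf μ ≡ just p × kindA p ≡ cont

  WellBracketed : List Act → Set
  WellBracketed ms =
    ∀ (i j : Fin (length ms)) → i <ᶠ j → Question (lookup ms i) → Answer (lookup ms j) →
    (∀ k → i <ᶠ k → k <ᶠ j → ¬ Arrow ms i k × ¬ Arrow ms k j) →
    Arrow ms i j

{-# OPTIONS --safe #-}
module Submission where

-- A trace is driven by the stack: a question pushes its continuation name,
-- an answer pops the top of the stack, every other visible action leaves the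
-- stack alone, and a τ may only discard an adjacent pair p^O, p^I.  (That no
-- other action is a question or an answer is where well-sortedness enters:
-- it is preserved by transitions, and sorts only allow a continuation name as
-- the last object of an output-controlled channel.)  So after a question μᵢ
-- has pushed p, everything pushed later sits above p; if no intermediate
-- action is pointed to by μᵢ or points to μⱼ, then by the time of the answer
-- μⱼ every such entry has been popped again, μⱼ pops p, and so μᵢ ↷ μⱼ.

open import Defs
open import Data.List using (List; []; _∷_; _++_; _∷ʳ_; [_]; map; length; lookup)
open import Data.List.Base using (initLast; _∷ʳ′_)
open import Data.List.Properties
  using (++-assoc; ++-conicalʳ; length-++; map-cong; map-∘; map-++; map-injective; ∷ʳ-injectiveʳ)
open import Data.List.Membership.Propositional using (_∈_; _∉_)
open import Data.List.Membership.Propositional.Properties using (∈-map⁺; ∈-++⁺ʳ; ∈-++⁺ˡ)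
open import Data.List.Relation.Unary.Any using (here; there)
open import Data.List.Relation.Unary.All as All using (All; []; _∷_)
open import Data.Nat using (zero; suc; z<s; s<s)
open import Data.Fin using (Fin; zero; suc) renaming (_<_ to _<ᶠ_)
open import Data.Maybe using (just)
open import Data.Maybe.Properties using (just-injective)
open import Data.Product using (∃; ∃₂; _×_; _,_; proj₁; proj₂)
import Data.Product as Product
open import Data.Empty using (⊥-elim)
open import Data.Unit using (⊤; tt)
open import Relation.Nullary using (¬_; yes; no)
open import Relation.Binary.PropositionalEquality using (_≡_; _≢_; refl; sym; trans; subst)

module _ (𝒮 : Sorting) where
  open Sorting 𝒮
  open Calculus 𝒮

  sortN-shift : ∀ s Γ n → sortN (s ∷ Γ) (shiftN n) ≡ sortN Γ n
  sortN-shift s Γ (fr a) = refl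
  sortN-shift s Γ (bv i) = refl

  sortN-pick : ∀ as Γ i → sortN (map srt as ++ Γ) (bv i) ≡ sortN Γ (pick as i)
  sortN-pick [] Γ i = refl
  sortN-pick (a ∷ as) Γ zero = refl
  sortN-pick (a ∷ as) Γ (suc i) = sortN-pick as Γ i

  sortN-open : ∀ Δ as Γ n →
               sortN (Δ ++ map srt as ++ Γ) n ≡ sortN (Δ ++ Γ) (openN (length Δ) as n)
  sortN-open Δ as Γ (fr a) = refl
  sortN-open [] as Γ (bv i) = sortN-pick as Γ i
  sortN-open (s ∷ Δ) as Γ (bv zero) = refl
  sortN-open (s ∷ Δ) as Γ (bv (suc i)) =
    trans (sortN-open Δ as Γ (bv i)) (sym (sortN-shift s (Δ ++ Γ) (opn (length Δ) as i)))

  sortN-bv-length : ∀ Δ s Γ → sortN (Δ ++ s ∷ Γ) (bv (length Δ)) ≡ just s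
  sortN-bv-length [] s Γ = refl
  sortN-bv-length (t ∷ Δ) s Γ = sortN-bv-length Δ s Γ

  sortN-close : ∀ Δ c Γ n → sortN (Δ ++ srt c ∷ Γ) (closeN (length Δ) c n) ≡ sortN (Δ ++ Γ) n
  sortN-close Δ c Γ (fr a) with a ≟A c
  ... | yes refl = sortN-bv-length Δ (srt a) Γ
  ... | no _ = refl
  sortN-close [] c Γ (bv i) = refl
  sortN-close (s ∷ Δ) c Γ (bv zero) = refl
  sortN-close (s ∷ Δ) c Γ (bv (suc i)) =
    trans (sortN-shift s (Δ ++ srt c ∷ Γ) (cls (length Δ) i)) (sortN-close Δ c Γ (bv i))

  -- The context and depth of the result are given up to equations, so that the
  -- binder cases can recurse with Δ extended by the bound sorts without transport.
  WS-open : ∀ Δ as Γ {Ξ P} → WS Ξ P → Ξ ≡ Δ ++ map srt as ++ Γ →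
            ∀ {Ξ′ d} → Ξ′ ≡ Δ ++ Γ → d ≡ length Δ → WS Ξ′ (openP d as P)
  WS-open Δ as Γ (wsOut {a} {bs} a∶s bs∶ob) refl refl refl =
    wsOut (trans (sym (sortN-open Δ as Γ a)) a∶s)
          (trans (sym (trans (map-cong (sortN-open Δ as Γ) bs) (map-∘ bs))) bs∶ob)
  WS-open Δ as Γ (wsRep {a} {ss} a∶s ss≡ob w) refl refl refl =
    wsRep (trans (sym (sortN-open Δ as Γ a)) a∶s) ss≡ob
          (WS-open (ss ++ Δ) as Γ w (sym (++-assoc ss Δ _))
                   (sym (++-assoc ss Δ Γ)) (sym (length-++ ss)))
  WS-open Δ as Γ (wsPar w₁ w₂) refl refl refl =
    wsPar (WS-open Δ as Γ w₁ refl refl refl) (WS-open Δ as Γ w₂ refl refl refl)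
  WS-open Δ as Γ (wsNu {s} w) refl refl refl = wsNu (WS-open (s ∷ Δ) as Γ w refl refl refl)
  WS-open Δ as Γ wsNil refl refl refl = wsNil
  WS-open Δ as Γ (wsInp {a} {ss} a∶s ss≡ob w) refl refl refl =
    wsInp (trans (sym (sortN-open Δ as Γ a)) a∶s) ss≡ob
          (WS-open (ss ++ Δ) as Γ w (sym (++-assoc ss Δ _))
                   (sym (++-assoc ss Δ Γ)) (sym (length-++ ss)))
  WS-open Δ as Γ (wsTau w) refl refl refl = wsTau (WS-open Δ as Γ w refl refl refl)
  WS-open Δ as Γ (wsMat {a} {b} a∶s s≠cont b∶t t≠cont w) refl refl refl =
    wsMat (trans (sym (sortN-open Δ as Γ a)) a∶s) s≠cont
          (trans (sym (sortN-open Δ as Γ b)) b∶t) t≠cont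
          (WS-open Δ as Γ w refl refl refl)
  WS-open Δ as Γ (wsSum w₁ w₂) refl refl refl =
    wsSum (WS-open Δ as Γ w₁ refl refl refl) (WS-open Δ as Γ w₂ refl refl refl)

  WS-close : ∀ Δ c Γ {Ξ P} → WS Ξ P → Ξ ≡ Δ ++ Γ →
             ∀ {Ξ′ d} → Ξ′ ≡ Δ ++ srt c ∷ Γ → d ≡ length Δ → WS Ξ′ (closeP d c P)
  WS-close Δ c Γ (wsOut {a} {bs} a∶s bs∶ob) refl refl refl =
    wsOut (trans (sortN-close Δ c Γ a) a∶s)
          (trans (trans (sym (map-∘ bs)) (map-cong (sortN-close Δ c Γ) bs)) bs∶ob)
  WS-close Δ c Γ (wsRep {a} {ss} a∶s ss≡ob w) refl refl refl =
    wsRep (trans (sortN-close Δ c Γ a) a∶s) ss≡ob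
          (WS-close (ss ++ Δ) c Γ w (sym (++-assoc ss Δ Γ))
                    (sym (++-assoc ss Δ _)) (sym (length-++ ss)))
  WS-close Δ c Γ (wsPar w₁ w₂) refl refl refl =
    wsPar (WS-close Δ c Γ w₁ refl refl refl) (WS-close Δ c Γ w₂ refl refl refl)
  WS-close Δ c Γ (wsNu {s} w) refl refl refl = wsNu (WS-close (s ∷ Δ) c Γ w refl refl refl)
  WS-close Δ c Γ wsNil refl refl refl = wsNil
  WS-close Δ c Γ (wsInp {a} {ss} a∶s ss≡ob w) refl refl refl =
    wsInp (trans (sortN-close Δ c Γ a) a∶s) ss≡ob
          (WS-close (ss ++ Δ) c Γ w (sym (++-assoc ss Δ Γ))
                    (sym (++-assoc ss Δ _)) (sym (length-++ ss)))
  WS-close Δ c Γ (wsTau w) refl refl refl = wsTau (WS-close Δ c Γ w refl refl refl)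
  WS-close Δ c Γ (wsMat {a} {b} a∶s s≠cont b∶t t≠cont w) refl refl refl =
    wsMat (trans (sortN-close Δ c Γ a) a∶s) s≠cont
          (trans (sortN-close Δ c Γ b) b∶t) t≠cont
          (WS-close Δ c Γ w refl refl refl)
  WS-close Δ c Γ (wsSum w₁ w₂) refl refl refl =
    wsSum (WS-close Δ c Γ w₁ refl refl refl) (WS-close Δ c Γ w₂ refl refl refl)

  WS-inst : ∀ {ss P} as → WS (ss ++ []) P → map srt as ≡ ss → WS [] (inst as P)
  WS-inst as w refl = WS-open [] as [] w refl refl refl

  WS-close-nu : ∀ {P} n → WS [] P → WS [] (nu (srt n) (closeP 0 n P))
  WS-close-nu n w = wsNu (WS-close [] n [] w refl refl refl)

  WS-nuClose : ∀ cs {R} → WS [] R → WS [] (nuClose cs R)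
  WS-nuClose [] w = w
  WS-nuClose (c ∷ cs) w = WS-close-nu c (WS-nuClose cs w)

  SortedAct : Act → Set
  SortedAct τ = ⊤
  SortedAct (inA a bs) = map srt bs ≡ ob (srt a)
  SortedAct (outA cs a bs) = map srt bs ≡ ob (srt a)

  sortN-map-fr : ∀ Γ bs → map (sortN Γ) (map fr bs) ≡ map just (map srt bs)
  sortN-map-fr Γ bs = trans (sym (map-∘ bs)) (map-∘ bs)

  subject-reduction : ∀ {P μ P′} → WS [] P → Step P μ P′ → WS [] P′ × SortedAct μ
  subject-reduction (wsOut refl bs∶ob) (sOut {bs = bs}) =
    wsNil , map-injective just-injective (trans (sym (sortN-map-fr [] bs)) bs∶ob)
  subject-reduction (wsInp refl ss≡ob w) (sInp {bs = bs} bs∶ss) =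
    WS-inst bs w bs∶ss , trans bs∶ss ss≡ob
  subject-reduction (wsRep refl ss≡ob w) (sRep {bs = bs} bs∶ss) =
    wsPar (WS-inst bs w bs∶ss) (wsRep refl ss≡ob w) , trans bs∶ss ss≡ob
  subject-reduction (wsTau w) sTau = w , tt
  subject-reduction (wsSum w₁ w₂) (sSumL st) = subject-reduction w₁ st
  subject-reduction (wsSum w₁ w₂) (sSumR st) = subject-reduction w₂ st
  subject-reduction (wsMat _ _ _ _ w) (sMat st) = subject-reduction w st
  subject-reduction (wsPar w₁ w₂) (sParL st _) =
    Product.map₁ (λ w₁′ → wsPar w₁′ w₂) (subject-reduction w₁ st)
  subject-reduction (wsPar w₁ w₂) (sParR st _) =
    Product.map₁ (wsPar w₁) (subject-reduction w₂ st)
  subject-reduction (wsPar w₁ w₂) (sComL {cs = cs} st₁ st₂ _) =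
    WS-nuClose cs (wsPar (proj₁ (subject-reduction w₁ st₁))
                         (proj₁ (subject-reduction w₂ st₂))) , tt
  subject-reduction (wsPar w₁ w₂) (sComR {cs = cs} st₁ st₂ _) =
    WS-nuClose cs (wsPar (proj₁ (subject-reduction w₁ st₁))
                         (proj₁ (subject-reduction w₂ st₂))) , tt
  subject-reduction (wsNu w) (sRes {n = n} refl _ _ st) =
    Product.map₁ (WS-close-nu n) (subject-reduction (WS-inst [ n ] w refl) st)
  subject-reduction (wsNu w) (sOpen {n = n} refl _ st _ _ _) =
    subject-reduction (WS-inst [ n ] w refl) st

  objects-not-cont : ∀ s {bs : List Atom} → kind s ≢ oc → map srt bs ≡ ob s →
                     ∀ {p} → p ∈ bs → kindA p ≢ cont
  objects-not-cont s s≠oc bs∶ob p∈bs =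
    All.lookup (subst (All (λ t → NotCont (kind t))) (sym bs∶ob) (noCont s s≠oc))
               (∈-map⁺ srt p∈bs)

  map-srt≡∷ʳ : ∀ (xs : List Atom) l c → map srt xs ≡ l ∷ʳ c →
               ∃₂ λ xs′ x → xs ≡ xs′ ∷ʳ x × srt x ≡ c
  map-srt≡∷ʳ xs l c eq with initLast xs
  ... | [] with () ← ++-conicalʳ l [ c ] (sym eq)
  ... | xs′ ∷ʳ′ x =
    xs′ , x , refl , ∷ʳ-injectiveʳ (map srt xs′) l (trans (sym (map-++ srt xs′ [ x ])) eq)

  non-last-objects-not-cont : ∀ s {bs} → NoLastCont bs → map srt bs ≡ ob s →
                              ∀ {p} → p ∈ bs → kindA p ≢ cont
  non-last-objects-not-cont s {bs} noLast bs∶ob p∈bs with kind s ≟K oc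
  ... | no s≠oc = objects-not-cont s s≠oc bs∶ob p∈bs
  ... | yes s≡oc with ocShape s s≡oc
  ...   | l , c , ob≡l∷ʳc , c≡cont , _ with map-srt≡∷ʳ bs l c (trans bs∶ob ob≡l∷ʳc)
  ...     | bs′ , b , refl , refl = λ _ → noLast bs′ b refl c≡cont

  ≡cont⇒≢oc : ∀ {k} → k ≡ cont → k ≢ oc
  ≡cont⇒≢oc refl ()

  answer⇒¬question : ∀ μ → SortedAct μ → Answer μ → ¬ Question μ
  answer⇒¬question (inA a bs) bs∶ob (_ , refl , a≡cont) (p , p∈bs , p≡cont) =
    objects-not-cont (srt a) (≡cont⇒≢oc a≡cont) bs∶ob p∈bs p≡cont
  answer⇒¬question (outA cs a bs) bs∶ob (_ , refl , a≡cont) (p , p∈bs , p≡cont) =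
    objects-not-cont (srt a) (≡cont⇒≢oc a≡cont) bs∶ob p∈bs p≡cont

  Pushes : Act → Tag × Atom → Set
  Pushes μ (I , p) = ∃₂ λ cs a → ∃ λ bs →
    μ ≡ outA cs a (bs ∷ʳ p) × NotCont (kindA a) × kindA p ≡ cont × p ∈ cs
  Pushes μ (O , p) = ∃₂ λ a bs → μ ≡ inA a (bs ∷ʳ p) × NotCont (kindA a) × kindA p ≡ cont

  Pops : Tag × Atom → Act → Set
  Pops (O , q) μ = ∃₂ λ cs bs → μ ≡ outA cs q bs
  Pops (I , q) μ = ∃ λ bs → μ ≡ inA q bs

  pushes-pops⇒points : ∀ {μ μ′} e → Pushes μ e → Pops e μ′ → Points μ μ′
  pushes-pops⇒points (I , p) (_ , _ , _ , refl , a≠cont , p≡cont , p∈cs) (_ , refl) =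
    ptOut a≠cont p≡cont p∈cs
  pushes-pops⇒points (O , p) (_ , _ , refl , a≠cont , p≡cont) (_ , _ , refl) =
    ptIn a≠cont p≡cont

  pushed∈objs : ∀ {μ} e → Pushes μ e → proj₂ e ∈ objs μ
  pushed∈objs (I , p) (_ , _ , bs , refl , _) = ∈-++⁺ʳ bs (here refl)
  pushed∈objs (O , p) (_ , bs , refl , _) = ∈-++⁺ʳ bs (here refl)

  pushed-cont : ∀ {μ} e → Pushes μ e → kindA (proj₂ e) ≡ cont
  pushed-cont (I , p) (_ , _ , _ , _ , _ , p≡cont , _) = p≡cont
  pushed-cont (O , p) (_ , _ , _ , _ , p≡cont) = p≡cont

  objs⊆namesA : ∀ μ {p} → p ∈ objs μ → p ∈ namesA μ
  objs⊆namesA (inA a bs) p∈bs = there p∈bs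
  objs⊆namesA (outA cs a bs) p∈bs = there (∈-++⁺ˡ p∈bs)

  data StackEffect (σ : Stack) (μ : Act) (σ′ : Stack) : Set where
    push    : ∀ e → ¬ Answer μ → Pushes μ e → proj₂ e ∉ names σ → σ′ ≡ e ∷ σ →
              StackEffect σ μ σ′
    pop     : ∀ e → ¬ Question μ → Pops e μ → σ ≡ e ∷ σ′ → StackEffect σ μ σ′
    keep    : ¬ Question μ → ¬ Answer μ → σ′ ≡ σ → StackEffect σ μ σ′
    popPair : ∀ p → μ ≡ τ → σ ≡ (O , p) ∷ (I , p) ∷ σ′ → StackEffect σ μ σ′

  subject-not-cont⇒¬answer : ∀ μ {a} → subjOf μ ≡ just a → NotCont (kindA a) → ¬ Answer μ
  subject-not-cont⇒¬answer μ subj≡a a≠cont (_ , subj≡q , q≡cont)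
    with refl ← trans (sym subj≡a) subj≡q = a≠cont q≡cont

  stackEffect : ∀ {σ μ P′ σ′} → StackStep σ μ P′ σ′ → SortedAct μ → DiscreetT σ μ →
                StackEffect σ μ σ′
  stackEffect (kOutC {cs = cs} {a} {bs} a≡cont) sorted _ =
    pop (O , a) (answer⇒¬question (outA cs a bs) sorted (a , refl , a≡cont))
        (cs , bs , refl) refl
  stackEffect (kInC {a = a} {bs} a≡cont) sorted _ =
    pop (I , a) (answer⇒¬question (inA a bs) sorted (a , refl , a≡cont)) (bs , refl) refl
  stackEffect (kOutQb {cs = cs} {a} {bs} {p} a≠cont p≡cont p∈cs) _ discreet =
    push (I , p) (subject-not-cont⇒¬answer (outA cs a (bs ∷ʳ p)) refl a≠cont)
         (cs , a , bs , refl , a≠cont , p≡cont , p∈cs)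
         (discreet p p≡cont (∈-++⁺ʳ bs (here refl))) refl
  stackEffect (kOutQf {bs = bs} {p} _ p≡cont _) _ discreet =
    ⊥-elim (discreet p p≡cont (∈-++⁺ʳ bs (here refl)) (here refl))
  stackEffect (kInQ {a = a} {bs} {p} a≠cont p≡cont) _ discreet =
    push (O , p) (subject-not-cont⇒¬answer (inA a (bs ∷ʳ p)) refl a≠cont)
         (a , bs , refl , a≠cont , p≡cont)
         (discreet p p≡cont (∈-++⁺ʳ bs (here refl))) refl
  stackEffect (kOut {cs = cs} {a} {bs} a≠cont noLast) sorted _ =
    keep (λ (_ , p∈bs , p≡cont) → non-last-objects-not-cont (srt a) noLast sorted p∈bs p≡cont)
         (subject-not-cont⇒¬answer (outA cs a bs) refl a≠cont) refl
  stackEffect (kIn {a = a} {bs} a≠cont noLast) sorted _ =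
    keep (λ (_ , p∈bs , p≡cont) → non-last-objects-not-cont (srt a) noLast sorted p∈bs p≡cont)
         (subject-not-cont⇒¬answer (inA a bs) refl a≠cont) refl
  stackEffect (kTauPop {p = p} _) _ _ = popPair p refl refl
  stackEffect (kTauKeep _) _ _ = keep (λ ()) (λ ()) refl

  data EffectRun : Stack → List Act → Set where
    []  : ∀ {σ} → EffectRun σ []
    _∷_ : ∀ {σ μ σ′ ms} → StackEffect σ μ σ′ → EffectRun σ′ ms → EffectRun σ (μ ∷ ms)

  run⇒effectRun : ∀ {σ P ms} → WS [] P → Run σ P ms → EffectRun σ ms
  run⇒effectRun _ rNil = []
  run⇒effectRun w (rCons ((_ , (_ , st , _) , _) , stackStep) discreet run) =
    stackEffect stackStep (proj₂ (subject-reduction w st)) discreet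
    ∷ run⇒effectRun (proj₁ (subject-reduction w st)) run

  Unrelated : Act → Act → Act → Set
  Unrelated μᵢ μ μⱼ = ¬ Points μᵢ μ × ¬ Points μ μⱼ

  -- The stack between a question that pushed e and the answer μⱼ.
  record EnclosedBy (μⱼ : Act) (e : Tag × Atom) (σ : Stack) : Set where
    constructor enclosed
    field
      above       : Stack
      below       : Stack
      split       : σ ≡ above ++ e ∷ below
      above-inert : All (λ r → proj₂ r ≢ proj₂ e × ¬ Pops r μⱼ) above
      below-fresh : proj₂ e ∉ names below

  enclosed-step : ∀ {μᵢ μⱼ μ e σ σ′} → Pushes μᵢ e → StackEffect σ μ σ′ →
                  proj₂ e ∉ objs μ → Unrelated μᵢ μ μⱼ →
                  EnclosedBy μⱼ e σ → EnclosedBy μⱼ e σ′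
  enclosed-step {μ = μ} _ (push r _ pushes-r _ refl) e∉objs (_ , ¬r↷μⱼ)
                (enclosed ρ below refl inert fresh) =
    enclosed (r ∷ ρ) below refl
      (((λ r≡e → e∉objs (subst (_∈ objs μ) r≡e (pushed∈objs r pushes-r)))
        , (λ pops-r → ¬r↷μⱼ (pushes-pops⇒points r pushes-r pops-r))) ∷ inert)
      fresh
  enclosed-step _ (keep _ _ refl) _ _ inv = inv
  enclosed-step {e = e} pushes-e (pop r _ pops-r refl) _ (¬μᵢ↷μ , _) (enclosed [] _ refl _ _) =
    ⊥-elim (¬μᵢ↷μ (pushes-pops⇒points e pushes-e pops-r))
  enclosed-step _ (pop r _ _ refl) _ _ (enclosed (r ∷ ρ) below refl (_ ∷ inert) fresh) =
    enclosed ρ below refl inert fresh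
  enclosed-step _ (popPair p _ refl) _ _ (enclosed [] _ refl _ fresh) =
    ⊥-elim (fresh (here refl))
  enclosed-step _ (popPair p _ refl) _ _ (enclosed (r ∷ []) _ refl ((r≠e , _) ∷ _) _) =
    ⊥-elim (r≠e refl)
  enclosed-step _ (popPair p _ refl) _ _ (enclosed (_ ∷ _ ∷ ρ) below refl (_ ∷ _ ∷ inert) fresh) =
    enclosed ρ below refl inert fresh

  enclosed-answer : ∀ {μᵢ μⱼ e σ σ′} → Pushes μᵢ e → StackEffect σ μⱼ σ′ → Answer μⱼ →
                    EnclosedBy μⱼ e σ → Points μᵢ μⱼ
  enclosed-answer _ (push _ ¬answer _ _ _) answer _ = ⊥-elim (¬answer answer)
  enclosed-answer _ (keep _ ¬answer _) answer _ = ⊥-elim (¬answer answer)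
  enclosed-answer _ (popPair _ refl _) (_ , () , _) _
  enclosed-answer {e = e} pushes-e (pop r _ pops-r refl) _ (enclosed [] _ refl _ _) =
    pushes-pops⇒points e pushes-e pops-r
  enclosed-answer _ (pop r _ pops-r refl) _ (enclosed (r ∷ _) _ refl ((_ , ¬pops-r) ∷ _) _) =
    ⊥-elim (¬pops-r pops-r)

  enclosed-run : ∀ {μᵢ μⱼ e σ ms} → Pushes μᵢ e → Answer μⱼ → EffectRun σ ms →
                 EnclosedBy μⱼ e σ → (∀ k → proj₂ e ∉ objs (lookup ms k)) →
                 (j : Fin (length ms)) → lookup ms j ≡ μⱼ →
                 (∀ k → k <ᶠ j → Unrelated μᵢ (lookup ms k) μⱼ) →
                 Points μᵢ μⱼ
  enclosed-run pushes answer (effect ∷ _) inv _ zero refl _ =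
    enclosed-answer pushes effect answer inv
  enclosed-run pushes answer (effect ∷ run) inv fresh (suc j) refl unrelated =
    enclosed-run pushes answer run
      (enclosed-step pushes effect (fresh zero) (unrelated zero z<s) inv)
      (λ k → fresh (suc k)) j refl (λ k k<j → unrelated (suc k) (s<s k<j))

  question-answered : ∀ {σ μ σ′ ms} → StackEffect σ μ σ′ → EffectRun σ′ ms → Question μ →
                      (∀ k p → kindA p ≡ cont → p ∈ objs (lookup ms k) → p ∉ namesA μ) →
                      (j : Fin (length ms)) → Answer (lookup ms j) →
                      (∀ k → k <ᶠ j → Unrelated μ (lookup ms k) (lookup ms j)) →
                      Points μ (lookup ms j)
  question-answered {μ = μ} (push e _ pushes e∉σ refl) run _ fresh j answer unrelated =
    enclosed-run pushes answer run (enclosed [] _ refl [] e∉σ)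
      (λ k e∈objs → fresh k (proj₂ e) (pushed-cont e pushes) e∈objs
                      (objs⊆namesA μ (pushed∈objs e pushes)))
      j refl unrelated
  question-answered (pop _ ¬question _ _) _ question _ _ _ _ = ⊥-elim (¬question question)
  question-answered (keep ¬question _ _) _ question _ _ _ _ = ⊥-elim (¬question question)
  question-answered (popPair _ refl _) _ (_ , () , _) _ _ _ _

  effectRun⇒wellBracketed : ∀ {σ ms} → EffectRun σ ms → FreshObjs ms → WellBracketed ms
  effectRun⇒wellBracketed (effect ∷ run) fresh zero (suc j) _ question answer unrelated =
    z<s , question-answered effect run question
            (λ k → fresh zero (suc k) z<s) j answer
            (λ k k<j → (λ μ↷ → proj₁ (unrelated (suc k) z<s (s<s k<j)) (z<s , μ↷))
                     , (λ ↷μⱼ → proj₂ (unrelated (suc k) z<s (s<s k<j)) (s<s k<j , ↷μⱼ)))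
  effectRun⇒wellBracketed (_ ∷ run) fresh (suc i) (suc j) (s<s i<j) question answer unrelated =
    Product.map₁ s<s
      (effectRun⇒wellBracketed run (λ i j i<j → fresh (suc i) (suc j) (s<s i<j))
         i j i<j question answer
         (λ k i<k k<j → Product.map (λ ¬arr (i<k , pts) → ¬arr (s<s i<k , pts))
                                    (λ ¬arr (k<j , pts) → ¬arr (s<s k<j , pts))
                                    (unrelated (suc k) (s<s i<k) (s<s k<j))))

mainTheorem15 : (𝒮 : Sorting) → let open Calculus 𝒮 in
    (P₀ : Proc) (σ₀ : Stack) (ms : List Act) →
    WellSorted P₀ → Discreet P₀ → Clean P₀ → IsStack σ₀ →
    IsTrace σ₀ P₀ ms → WellBracketed ms
mainTheorem15 𝒮 P₀ σ₀ ms wellSorted _ _ _ (run , fresh) =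
  effectRun⇒wellBracketed 𝒮 (run⇒effectRun 𝒮 wellSorted run) fresh
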